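{- For any agent $i$, the agreement function $\mathrm{agr}_i:2^{\mathcal L}\to\mathbb{N}_{\ge0}$ is submodular, i.e., $\mathrm{agr}_i(\mathcal S)+\mathrm{agr}_i(\mathcal H)\ge\mathrm{agr}_i(\mathcal S\cup\mathcal H)+\mathrm{agr}_i(\mathcal S\cap\mathcal H)$ for all $\mathcal S,\mathcal H\subseteq\mathcal L$.
   Context: Time is discrete; $T=\{1,\dots,|T|\}$. Events $e\in E$ have lengths $l(e)$; the pair $(e,t)$ means event $e$ occupies slots $\{t,\dots,t+l(e)-1\}$. $\mathcal L=\{(e,t):e\in E,t\in T\}$. For $\mathcal S\subseteq\mathcal L$, the occupied set $\mathrm{st}(\mathcal S)$ is the union of slots occupied by the pairs in $\mathcal S$. Agent $i$ has a job set $J_i$, each job $j$ with release time $r_j$, deadline $d_j$, processing time $p_j\le d_j-r_j+1$; a preemptive job schedule is feasible if each job gets $p_j$ distinct slots in $\{r_j,\dots,d_j\}$ and each slot holds at most one job; $J_i$ is assumed feasible. $\mathrm{agr}_i(\mathcal S)$ is the maximum, over feasible job schedules of $J_i$, of the number of slots in $\mathrm{st}(\mathcal S)$ where no job of $J_i$ is processed. -}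

module Defs where

open import Data.Nat using (ℕ; zero; suc; _+_; _≤_; _<ᵇ_; _≤ᵇ_)
open import Data.Bool using (Bool; true; false; _∧_; _∨_; if_then_else_; not)
open import Data.Fin using (Fin; toℕ; _≟_)
import Data.Fin as F
open import Data.Maybe using (Maybe; just; nothing)
open import Data.Product using (Σ; _×_; ∃)
open import Relation.Nullary.Decidable using (⌊_⌋)
open import Relation.Binary.PropositionalEquality using (_≡_)

-- Time slots are natural numbers; T = {1,…,τ}; the element t : Fin τ denotes slot 1 + toℕ t.
slotOf : {τ : ℕ} → Fin τ → ℕ
slotOf t = suc (toℕ t)

anyFin : {k : ℕ} → (Fin k → Bool) → Bool
anyFin {zero}  f = false
anyFin {suc k} f = f F.zero ∨ anyFin (λ i → f (F.suc i))

sumFin : {k : ℕ} → (Fin k → ℕ) → ℕ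
sumFin {zero}  f = 0
sumFin {suc k} f = f F.zero + sumFin (λ i → f (F.suc i))

count : (ℕ → Bool) → ℕ → ℕ
count f zero    = 0
count f (suc N) = (if f N then 1 else 0) + count f N

-- Subsets of 𝓛 = E × T with E = Fin n, T = Fin τ
PairSet : ℕ → ℕ → Set
PairSet n τ = Fin n → Fin τ → Bool

_∪ᴸ_ : {n τ : ℕ} → PairSet n τ → PairSet n τ → PairSet n τ
(S ∪ᴸ H) e t = S e t ∨ H e t

_∩ᴸ_ : {n τ : ℕ} → PairSet n τ → PairSet n τ → PairSet n τ
(S ∩ᴸ H) e t = S e t ∧ H e t

inSt : {n τ : ℕ} → (Fin n → ℕ) → PairSet n τ → ℕ → Bool
inSt l S u = anyFin (λ e → anyFin (λ t →
  S e t ∧ (slotOf t ≤ᵇ u) ∧ (u <ᵇ slotOf t + l e)))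

-- a bound strictly exceeding every slot that can lie in st(S)
slotBound : {n : ℕ} → ℕ → (Fin n → ℕ) → ℕ
slotBound τ l = suc (τ + sumFin l)

record Job : Set where
  field
    r : ℕ
    d : ℕ
    p : ℕ
    p≤window : p + r ≤ suc d      -- p ≤ d - r + 1
open Job public

Schedule : ℕ → Set
Schedule m = ℕ → Maybe (Fin m)

runs : {m : ℕ} → Schedule m → Fin m → ℕ → Bool
runs σ j u with σ u
... | nothing = false
... | just k  = ⌊ k ≟ j ⌋

idleAt : {m : ℕ} → Schedule m → ℕ → Bool
idleAt σ u with σ u
... | nothing = true
... | just _  = false

Feasible : {m : ℕ} → (Fin m → Job) → Schedule m → Set
Feasible J σ =
  (∀ j u → runs σ j u ≡ true → (r (J j) ≤ u × u ≤ d (J j)))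
  × (∀ j → count (runs σ j) (suc (d (J j))) ≡ p (J j))

idleIn : {n τ m : ℕ} → (Fin n → ℕ) → PairSet n τ → Schedule m → ℕ
idleIn {τ = τ} l S σ = count (λ u → inSt l S u ∧ idleAt σ u) (slotBound τ l)

IsAgr : {n τ m : ℕ} → (Fin n → ℕ) → (Fin m → Job) → PairSet n τ → ℕ → Set
IsAgr l J S k =
  (Σ _ λ σ → Feasible J σ × idleIn l S σ ≡ k)
  × (∀ σ → Feasible J σ → idleIn l S σ ≤ k)

JobsFeasible : {m : ℕ} → (Fin m → Job) → Set
JobsFeasible J = Σ _ λ σ → Feasible J σ

{-# OPTIONS --safe #-}
-- For a fixed schedule σ the number of idle slots in st(𝒮) is submodular in 𝒮, because
-- st(𝒮 ∪ ℋ) = st 𝒮 ∪ st ℋ and st(𝒮 ∩ ℋ) ⊆ st 𝒮 ∩ st ℋ.  So it suffices to find one feasible σ that is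
-- at least as good as an optimal σ₁ for 𝒮 ∪ ℋ and as an optimal σ₂ for 𝒮 ∩ ℋ.  Start from σ₁.  While some
-- slot u of st(𝒮 ∩ ℋ) is idle under σ₂ but busy under σ, empty u and repair the job k that ran there along
-- an augmenting path guided by σ₂: put k into a slot w where σ₂ runs k but σ does not, and if w was held by
-- another job, repair that job in turn.  Every move makes the schedule agree with σ₂ at one more slot, so
-- the path ends, at a formerly idle slot v that is busy under σ₂.  The idle set changes by +u −v, which does
-- not lower the idle count on st(𝒮 ∪ ℋ) and removes one conflict with σ₂ on st(𝒮 ∩ ℋ).
module Submission where

open import Defs
open import Data.Nat using (ℕ; _+_; _≤_)
open import Data.Fin using (Fin)
open import Data.Product using (_×_)

open import Algebra.Bundles using (CommutativeMonoid)
open import Data.Bool using (Bool; true; false; _∧_; _∨_; not; if_then_else_)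
import Data.Bool as Bool
open import Data.Bool.Properties using (not-injective; ∧-zeroʳ; ∨-zeroʳ; ∨-commutativeMonoid; ∧-distribʳ-∨)
import Data.Fin as Fin
open import Data.Maybe using (Maybe; just; nothing; is-nothing)
open import Data.Maybe.Properties using (≡-dec; just-injective)
open import Data.Nat using (zero; suc; _<_; z≤n; s≤s; s≤s⁻¹; _≟_; _≤ᵇ_; _<ᵇ_)
open import Data.Nat.Induction using (<-wellFounded)
open import Data.Nat.Properties
open import Data.Product using (_,_; ∃-syntax; proj₂)
import Data.Product as Product
open import Function using (_∘_)
open import Induction.WellFounded using (Acc; acc)
open import Relation.Binary.PropositionalEquality
open import Relation.Nullary using (¬_; yes; no; does; contradiction)
open import Relation.Nullary.Decidable using (⌊_⌋; dec-true; dec-false)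
open import Algebra.Properties.CommutativeSemigroup
  (CommutativeMonoid.commutativeSemigroup ∨-commutativeMonoid) using (interchange)

-- Counting

𝟙 : Bool → ℕ
𝟙 b = if b then 1 else 0

𝟙≤1 : ∀ b → 𝟙 b ≤ 1
𝟙≤1 false = z≤n
𝟙≤1 true  = ≤-refl

𝟙-mono : ∀ {a b} → (a ≡ true → b ≡ true) → 𝟙 a ≤ 𝟙 b
𝟙-mono {false}         _   = z≤n
𝟙-mono {true} {true}   _   = ≤-refl
𝟙-mono {true} {false}  a⇒b with () ← a⇒b refl

∧-monoˡ-true : ∀ {a b c} → (a ≡ true → b ≡ true) → a ∧ c ≡ true → b ∧ c ≡ true
∧-monoˡ-true {true} a⇒b ac rewrite a⇒b refl = ac

∧-trueˡ : ∀ {a b} → a ∧ b ≡ true → a ≡ true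
∧-trueˡ {true} _ = refl

∧-trueʳ : ∀ {a b} → a ∧ b ≡ true → b ≡ true
∧-trueʳ {true} ab = ab

_≗_except_ : {A : Set} → (ℕ → A) → (ℕ → A) → ℕ → Set
f ≗ g except w = ∀ {u} → u ≢ w → f u ≡ g u

witness-below : ∀ {N} {P : ℕ → Set} → ∃[ u ] u < N × P u → ∃[ u ] u < suc N × P u
witness-below = Product.map₂ (Product.map₁ m<n⇒m<1+n)

module _ {f g : ℕ → Bool} where

  count-cong : ∀ N → (∀ {u} → u < N → f u ≡ g u) → count f N ≡ count g N
  count-cong zero    _   = refl
  count-cong (suc N) f≗g =
    cong₂ _+_ (cong 𝟙 (f≗g (n<1+n N))) (count-cong N (f≗g ∘ m<n⇒m<1+n))

  count-mono : ∀ N → (∀ {u} → u < N → f u ≡ true → g u ≡ true) → count f N ≤ count g N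
  count-mono zero    _   = z≤n
  count-mono (suc N) f⊆g = +-mono-≤ (𝟙-mono (f⊆g (n<1+n N))) (count-mono N (f⊆g ∘ m<n⇒m<1+n))

  count-update : ∀ {w} N → w < N → f ≗ g except w → count f N + 𝟙 (g w) ≡ count g N + 𝟙 (f w)
  count-update {w} (suc N) w<1+N f≗g with w ≟ N
  ... | yes refl = begin
    𝟙 (f w) + count f w + 𝟙 (g w) ≡⟨ cong (λ c → 𝟙 (f w) + c + 𝟙 (g w)) (count-cong w (f≗g ∘ <⇒≢)) ⟩
    𝟙 (f w) + count g w + 𝟙 (g w) ≡⟨ +-comm (𝟙 (f w) + count g w) (𝟙 (g w)) ⟩
    𝟙 (g w) + (𝟙 (f w) + count g w) ≡⟨ cong (𝟙 (g w) +_) (+-comm (𝟙 (f w)) (count g w)) ⟩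
    𝟙 (g w) + (count g w + 𝟙 (f w)) ≡⟨ +-assoc (𝟙 (g w)) (count g w) (𝟙 (f w)) ⟨
    𝟙 (g w) + count g w + 𝟙 (f w) ∎
    where open ≡-Reasoning
  ... | no w≢N = begin
    𝟙 (f N) + count f N + 𝟙 (g w)   ≡⟨ +-assoc (𝟙 (f N)) (count f N) (𝟙 (g w)) ⟩
    𝟙 (f N) + (count f N + 𝟙 (g w)) ≡⟨ cong₂ _+_ (cong 𝟙 (f≗g (w≢N ∘ sym)))
                                                  (count-update N (≤∧≢⇒< (≤-pred w<1+N) w≢N) f≗g) ⟩
    𝟙 (g N) + (count g N + 𝟙 (f w)) ≡⟨ +-assoc (𝟙 (g N)) (count g N) (𝟙 (f w)) ⟨
    𝟙 (g N) + count g N + 𝟙 (f w)   ∎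
    where open ≡-Reasoning

  count-flip : ∀ {w} N → w < N → f ≗ g except w → f w ≡ false → g w ≡ true → suc (count f N) ≡ count g N
  count-flip {w} N w<N f≗g fw gw = begin
    suc (count f N)     ≡⟨ +-comm 1 (count f N) ⟩
    count f N + 1       ≡⟨ cong (λ b → count f N + 𝟙 b) gw ⟨
    count f N + 𝟙 (g w) ≡⟨ count-update N w<N f≗g ⟩
    count g N + 𝟙 (f w) ≡⟨ cong (λ b → count g N + 𝟙 b) fw ⟩
    count g N + 0       ≡⟨ +-identityʳ (count g N) ⟩
    count g N           ∎
    where open ≡-Reasoning

  count-except-≤ : ∀ {w} N → w < N → f ≗ g except w → count f N ≤ suc (count g N)
  count-except-≤ {w} N w<N f≗g = begin
    count f N           ≤⟨ m≤m+n (count f N) (𝟙 (g w)) ⟩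
    count f N + 𝟙 (g w) ≡⟨ count-update N w<N f≗g ⟩
    count g N + 𝟙 (f w) ≤⟨ +-monoʳ-≤ (count g N) (𝟙≤1 (f w)) ⟩
    count g N + 1       ≡⟨ +-comm (count g N) 1 ⟩
    suc (count g N)     ∎
    where open ≤-Reasoning

  count-witness : ∀ N → count f N < count g N → ∃[ u ] u < N × f u ≡ false × g u ≡ true
  count-witness (suc N) lt with f N in fN | g N in gN
  ... | false | true  = N , ≤-refl , fN , gN
  ... | true  | true  = witness-below (count-witness N (≤-pred lt))
  ... | false | false = witness-below (count-witness N lt)
  ... | true  | false = witness-below (count-witness N (<-trans (n<1+n _) lt))

  count-∨-∧ : ∀ N → count (λ u → f u ∨ g u) N + count (λ u → f u ∧ g u) N ≡ count f N + count g N
  count-∨-∧ zero = refl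
  count-∨-∧ (suc N) with f N | g N | count-∨-∧ N
  ... | true  | true  | ih = cong suc (trans (+-suc _ _) (trans (cong suc ih) (sym (+-suc _ _))))
  ... | true  | false | ih = cong suc ih
  ... | false | true  | ih = trans (cong suc ih) (sym (+-suc _ _))
  ... | false | false | ih = ih

-- Occupied slots

anyFin-cong : ∀ {k} {f g : Fin k → Bool} → (∀ i → f i ≡ g i) → anyFin f ≡ anyFin g
anyFin-cong {zero}  f≗g = refl
anyFin-cong {suc k} f≗g = cong₂ _∨_ (f≗g Fin.zero) (anyFin-cong (f≗g ∘ Fin.suc))

anyFin-∨ : ∀ {k} (f g : Fin k → Bool) → anyFin (λ i → f i ∨ g i) ≡ anyFin f ∨ anyFin g
anyFin-∨ {zero}  f g = refl
anyFin-∨ {suc k} f g = trans (cong ((f Fin.zero ∨ g Fin.zero) ∨_) (anyFin-∨ (f ∘ Fin.suc) (g ∘ Fin.suc)))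
                             (interchange (f Fin.zero) (g Fin.zero) _ _)

anyFin-mono : ∀ {k} {f g : Fin k → Bool} → (∀ i → f i ≡ true → g i ≡ true) → anyFin f ≡ true → anyFin g ≡ true
anyFin-mono {suc k} {f} {g} f⊆g any-f with f Fin.zero in f₀
... | true  rewrite f⊆g Fin.zero f₀ = refl
... | false = trans (cong (g Fin.zero ∨_) (anyFin-mono (f⊆g ∘ Fin.suc) any-f)) (∨-zeroʳ (g Fin.zero))

module _ {n τ : ℕ} (l : Fin n → ℕ) where

  inSt-mono : ∀ {S S′ : PairSet n τ} → (∀ {e t} → S e t ≡ true → S′ e t ≡ true) →
              ∀ u → inSt l S u ≡ true → inSt l S′ u ≡ true
  inSt-mono {S} {S′} S⊆S′ u = anyFin-mono λ e → anyFin-mono λ t → ∧-monoˡ-true {S e t} {S′ e t} S⊆S′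

  module _ (S H : PairSet n τ) where

    inSt-∪ : ∀ u → inSt l (S ∪ᴸ H) u ≡ inSt l S u ∨ inSt l H u
    inSt-∪ u = trans (anyFin-cong λ e → trans (anyFin-cong λ t → ∧-distribʳ-∨ (covers e t) (S e t) (H e t))
                                              (anyFin-∨ (λ t → S e t ∧ covers e t) (λ t → H e t ∧ covers e t)))
                     (anyFin-∨ (λ e → anyFin λ t → S e t ∧ covers e t) (λ e → anyFin λ t → H e t ∧ covers e t))
      where
      covers : Fin n → Fin τ → Bool
      covers e t = (slotOf t ≤ᵇ u) ∧ (u <ᵇ slotOf t + l e)

    inSt-∩ˡ : ∀ u → inSt l (S ∩ᴸ H) u ≡ true → inSt l S u ≡ true
    inSt-∩ˡ = inSt-mono {S ∩ᴸ H} {S} ∧-trueˡ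

    inSt-∩ʳ : ∀ u → inSt l (S ∩ᴸ H) u ≡ true → inSt l H u ≡ true
    inSt-∩ʳ = inSt-mono {S ∩ᴸ H} {H} (λ {e} {t} → ∧-trueʳ {S e t})

    idleIn-submodular : ∀ {m} (σ : Schedule m) →
                        idleIn l (S ∪ᴸ H) σ + idleIn l (S ∩ᴸ H) σ ≤ idleIn l S σ + idleIn l H σ
    idleIn-submodular σ = begin
      idleIn l (S ∪ᴸ H) σ + idleIn l (S ∩ᴸ H) σ
        ≤⟨ +-mono-≤ (≤-reflexive (count-cong N (λ {u} _ → union u))) (count-mono N inter) ⟩
      count (λ u → idleˢ u ∨ idleᴴ u) N + count (λ u → idleˢ u ∧ idleᴴ u) N
        ≡⟨ count-∨-∧ {idleˢ} {idleᴴ} N ⟩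
      idleIn l S σ + idleIn l H σ ∎
      where
      open ≤-Reasoning
      N = slotBound τ l
      idleˢ idleᴴ : ℕ → Bool
      idleˢ u = inSt l S u ∧ idleAt σ u
      idleᴴ u = inSt l H u ∧ idleAt σ u
      union : ∀ u → inSt l (S ∪ᴸ H) u ∧ idleAt σ u ≡ idleˢ u ∨ idleᴴ u
      union u = trans (cong (_∧ idleAt σ u) (inSt-∪ u)) (∧-distribʳ-∨ (idleAt σ u) (inSt l S u) (inSt l H u))
      inter : ∀ {u} → u < N → inSt l (S ∩ᴸ H) u ∧ idleAt σ u ≡ true → idleˢ u ∧ idleᴴ u ≡ true
      inter {u} _ = split-idle {inSt l (S ∩ᴸ H) u} {inSt l S u} {inSt l H u} {idleAt σ u} (inSt-∩ˡ u) (inSt-∩ʳ u)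
        where
        split-idle : ∀ {z a b i} → (z ≡ true → a ≡ true) → (z ≡ true → b ≡ true) →
                     z ∧ i ≡ true → (a ∧ i) ∧ (b ∧ i) ≡ true
        split-idle {true} {i = true} z⇒a z⇒b _ rewrite z⇒a refl | z⇒b refl = refl

-- Schedules

_[_≔_] : {A : Set} → (ℕ → A) → ℕ → A → ℕ → A
(f [ w ≔ a ]) u with u ≟ w
... | yes _ = a
... | no  _ = f u

update-at : ∀ {A : Set} (f : ℕ → A) w a → (f [ w ≔ a ]) w ≡ a
update-at f w a with w ≟ w
... | yes _   = refl
... | no w≢w = contradiction refl w≢w

update-except : ∀ {A : Set} (f : ℕ → A) w a → (f [ w ≔ a ]) ≗ f except w
update-except f w a {u} u≢w with u ≟ w
... | yes u≡w = contradiction u≡w u≢w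
... | no  _   = refl

except-at : ∀ {A : Set} {f g : ℕ → A} {w} → f ≗ g except w → f w ≡ g w → f ≗ g
except-at {w = w} f≗g fw≡gw u with u ≟ w
... | yes refl = fw≡gw
... | no  u≢w  = f≗g u≢w

occupies : ∀ {m} → Fin m → Maybe (Fin m) → Bool
occupies j nothing  = false
occupies j (just k) = ⌊ k Fin.≟ j ⌋

occupies-self : ∀ {m} (j : Fin m) → occupies j (just j) ≡ true
occupies-self j with j Fin.≟ j
... | yes _   = refl
... | no j≢j = contradiction refl j≢j

occupies-other : ∀ {m} {j k : Fin m} → k ≢ j → occupies j (just k) ≡ false
occupies-other {j = j} {k} k≢j with k Fin.≟ j
... | yes k≡j = contradiction k≡j k≢j
... | no  _   = refl

occupies⇒just : ∀ {m} {j : Fin m} o → occupies j o ≡ true → o ≡ just j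
occupies⇒just {j = j} (just k) occ with k Fin.≟ j
... | yes refl = refl

runs≡occupies : ∀ {m} (σ : Schedule m) j u → runs σ j u ≡ occupies j (σ u)
runs≡occupies σ j u with σ u
... | nothing = refl
... | just _  = refl

idleAt≡is-nothing : ∀ {m} (σ : Schedule m) u → idleAt σ u ≡ is-nothing (σ u)
idleAt≡is-nothing σ u with σ u
... | nothing = refl
... | just _  = refl

busy⇒just : ∀ {m} (σ : Schedule m) u → idleAt σ u ≡ false → ∃[ k ] σ u ≡ just k
busy⇒just σ u busy with σ u
... | just k = k , refl

module _ {m : ℕ} (σ : Schedule m) (w : ℕ) (o : Maybe (Fin m)) where

  runs-update-at : ∀ j → runs (σ [ w ≔ o ]) j w ≡ occupies j o
  runs-update-at j = trans (runs≡occupies (σ [ w ≔ o ]) j w) (cong (occupies j) (update-at σ w o))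

  runs-update : ∀ j → runs (σ [ w ≔ o ]) j ≗ runs σ j except w
  runs-update j {u} u≢w = trans (runs≡occupies (σ [ w ≔ o ]) j u)
    (trans (cong (occupies j) (update-except σ w o u≢w)) (sym (runs≡occupies σ j u)))

  idleAt-update-at : idleAt (σ [ w ≔ o ]) w ≡ is-nothing o
  idleAt-update-at = trans (idleAt≡is-nothing (σ [ w ≔ o ]) w) (cong is-nothing (update-at σ w o))

  idleAt-update : idleAt (σ [ w ≔ o ]) ≗ idleAt σ except w
  idleAt-update {u} u≢w = trans (idleAt≡is-nothing (σ [ w ≔ o ]) u)
    (trans (cong is-nothing (update-except σ w o u≢w)) (sym (idleAt≡is-nothing σ u)))

module _ {m : ℕ} (J : Fin m → Job) where

  InWindows : Schedule m → Set
  InWindows σ = ∀ {k u} → σ u ≡ just k → r (J k) ≤ u × u ≤ d (J k)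

  load : Schedule m → Fin m → ℕ
  load σ k = count (runs σ k) (suc (d (J k)))

  feasible⇒inWindows : ∀ {σ} → Feasible J σ → InWindows σ
  feasible⇒inWindows {σ} (inside , _) {k} {u} σu≡k =
    inside k u (trans (runs≡occupies σ k u) (trans (cong (occupies k) σu≡k) (occupies-self k)))

  inWindows⇒feasible : ∀ {σ} → InWindows σ → (∀ k → load σ k ≡ p (J k)) → Feasible J σ
  inWindows⇒feasible {σ} inside loads =
    (λ k u runs-k → inside (occupies⇒just (σ u) (trans (sym (runs≡occupies σ k u)) runs-k))) , loads

  inWindows-update : ∀ {σ w o} → InWindows σ → (∀ {k} → o ≡ just k → r (J k) ≤ w × w ≤ d (J k)) →
                     InWindows (σ [ w ≔ o ])
  inWindows-update {σ} {w} {o} inside o-fits {k} {u} σ′u≡k with u ≟ w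
  -- matching on u ≟ w also unfolds the update inside the type of σ′u≡k
  ... | yes refl = o-fits σ′u≡k
  ... | no  _    = inside σ′u≡k

  module _ (σ : Schedule m) {w : ℕ} {o : Maybe (Fin m)} (k : Fin m) where

    load-unchanged : occupies k o ≡ occupies k (σ w) → load (σ [ w ≔ o ]) k ≡ load σ k
    load-unchanged same = count-cong (suc (d (J k))) λ {u} _ →
      except-at (runs-update σ w o k)
        (trans (runs-update-at σ w o k) (trans same (sym (runs≡occupies σ k w)))) u

    load-gained : w ≤ d (J k) → occupies k (σ w) ≡ false → occupies k o ≡ true →
                  load (σ [ w ≔ o ]) k ≡ suc (load σ k)
    load-gained w≤d before after = sym (count-flip (suc (d (J k))) (s≤s w≤d)
      (λ u≢w → sym (runs-update σ w o k u≢w))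
      (trans (runs≡occupies σ k w) before) (trans (runs-update-at σ w o k) after))

    load-lost : w ≤ d (J k) → occupies k (σ w) ≡ true → occupies k o ≡ false →
                suc (load (σ [ w ≔ o ]) k) ≡ load σ k
    load-lost w≤d before after = count-flip (suc (d (J k))) (s≤s w≤d)
      (runs-update σ w o k)
      (trans (runs-update-at σ w o k) after) (trans (runs≡occupies σ k w) before)

  record OneShort (ρ : Schedule m) (j : Fin m) : Set where
    field
      inWindows  : InWindows ρ
      load-short : suc (load ρ j) ≡ p (J j)
      load-rest  : ∀ k → k ≢ j → load ρ k ≡ p (J k)

  vacate : ∀ {σ u k} → Feasible J σ → σ u ≡ just k → OneShort (σ [ u ≔ nothing ]) k
  vacate {σ} {u} {k} feasible σu≡k = record
    { inWindows  = inWindows-update {σ} inside λ ()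
    ; load-short = trans (load-lost σ k (proj₂ (inside σu≡k)) (trans (cong (occupies k) σu≡k) (occupies-self k)) refl)
                         (proj₂ feasible k)
    ; load-rest  = λ k′ k′≢k → trans (load-unchanged σ k′ (sym (trans (cong (occupies k′) σu≡k) (occupies-other (k′≢k ∘ sym)))))
                                    (proj₂ feasible k′)
    }
    where inside = feasible⇒inWindows {σ} feasible

-- The exchange argument

differs : ∀ {m} → Maybe (Fin m) → Maybe (Fin m) → Bool
differs o o′ = not (does (≡-dec Fin._≟_ o o′))

differs-refl : ∀ {m} (o : Maybe (Fin m)) → differs o o ≡ false
differs-refl o = cong not (dec-true (≡-dec Fin._≟_ o o) refl)

differs-≢ : ∀ {m} {o o′ : Maybe (Fin m)} → o ≢ o′ → differs o o′ ≡ true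
differs-≢ {o = o} {o′} o≢o′ = cong not (dec-false (≡-dec Fin._≟_ o o′) o≢o′)

module Exchange {m τ : ℕ} (J : Fin m → Job) (deadline≤τ : ∀ k → d (J k) ≤ τ)
                {σ₂ : Schedule m} (feasible₂ : Feasible J σ₂) where

  disagreements : Schedule m → ℕ
  disagreements ρ = count (λ u → differs (ρ u) (σ₂ u)) (suc τ)

  missing-slot : ∀ {ρ j} → OneShort J ρ j → ∃[ w ] σ₂ w ≡ just j × occupies j (ρ w) ≡ false
  missing-slot {ρ} {j} short
    with count-witness {runs ρ j} {runs σ₂ j} (suc (d (J j)))
                       (≤-reflexive (trans (OneShort.load-short short) (sym (proj₂ feasible₂ j))))
  ... | w , _ , ρ-skips , σ₂-runs =
    w , occupies⇒just (σ₂ w) (trans (sym (runs≡occupies σ₂ j w)) σ₂-runs) ,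
    trans (sym (runs≡occupies ρ j w)) ρ-skips

  module Fill {ρ j w} (short : OneShort J ρ j) (σ₂w≡j : σ₂ w ≡ just j) (ρw≢j : occupies j (ρ w) ≡ false) where
    open OneShort short

    w-fits : r (J j) ≤ w × w ≤ d (J j)
    w-fits = feasible⇒inWindows J {σ₂} feasible₂ σ₂w≡j

    filled : Schedule m
    filled = ρ [ w ≔ just j ]

    filled-inWindows : InWindows J filled
    filled-inWindows = inWindows-update J {ρ} inWindows λ { refl → w-fits }

    filled-load : load J filled j ≡ p (J j)
    filled-load = trans (load-gained J ρ j (proj₂ w-fits) ρw≢j (occupies-self j)) load-short

    filled-loads : ∀ k → occupies k (ρ w) ≡ false → load J filled k ≡ p (J k)
    filled-loads k ρw≢k with k Fin.≟ j
    ... | yes refl = filled-load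
    ... | no  k≢j  =
      trans (load-unchanged J ρ k (trans (occupies-other (k≢j ∘ sym)) (sym ρw≢k))) (load-rest k k≢j)

    filled-feasible : ρ w ≡ nothing → Feasible J filled
    filled-feasible ρw≡nothing =
      inWindows⇒feasible J {filled} filled-inWindows λ k → filled-loads k (cong (occupies k) ρw≡nothing)

    module Displaced {k} (ρw≡k : ρ w ≡ just k) where

      k≢j : k ≢ j
      k≢j refl with () ← trans (sym (occupies-self j)) (trans (cong (occupies j) (sym ρw≡k)) ρw≢j)

      filled-oneShort : OneShort J filled k
      filled-oneShort = record
        { inWindows  = filled-inWindows
        ; load-short = trans (load-lost J ρ k (proj₂ (inWindows ρw≡k))
                                        (trans (cong (occupies k) ρw≡k) (occupies-self k))
                                        (occupies-other (k≢j ∘ sym)))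
                             (load-rest k k≢j)
        ; load-rest  = λ k′ k′≢k →
            filled-loads k′ (trans (cong (occupies k′) ρw≡k) (occupies-other (k′≢k ∘ sym)))
        }

      filled-fewer-disagreements : disagreements filled < disagreements ρ
      filled-fewer-disagreements = ≤-reflexive (count-flip (suc τ) (s≤s (≤-trans (proj₂ w-fits) (deadline≤τ j)))
        (λ u≢w → cong (λ o → differs o (σ₂ _)) (update-except ρ w (just j) u≢w))
        (trans (cong₂ differs (update-at ρ w (just j)) σ₂w≡j) (differs-refl (just j)))
        (trans (cong₂ differs ρw≡k σ₂w≡j) (differs-≢ (k≢j ∘ just-injective))))

      filled-idle : ∀ u → idleAt filled u ≡ idleAt ρ u
      filled-idle = except-at (idleAt-update ρ w (just j))
        (trans (idleAt-update-at ρ w (just j)) (sym (trans (idleAt≡is-nothing ρ w) (cong is-nothing ρw≡k))))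

  record Repair (ρ : Schedule m) : Set where
    constructor repaired
    field
      schedule    : Schedule m
      slot        : ℕ
      feasible    : Feasible J schedule
      σ₂-busy     : idleAt σ₂ slot ≡ false
      idle-agrees : idleAt schedule ≗ idleAt ρ except slot

  augment : ∀ {ρ j} → OneShort J ρ j → Acc _<_ (disagreements ρ) → Repair ρ
  augment {ρ} {j} short (acc smaller) with missing-slot short
  ... | w , σ₂w≡j , ρw≢j = extend (ρ w) refl
    where
    open Fill short σ₂w≡j ρw≢j
    extend : ∀ o → ρ w ≡ o → Repair ρ
    extend nothing ρw≡nothing =
      repaired filled w (filled-feasible ρw≡nothing) (trans (idleAt≡is-nothing σ₂ w) (cong is-nothing σ₂w≡j))
               (idleAt-update ρ w (just j))
    extend (just k) ρw≡k =
      repaired schedule slot feasible σ₂-busy λ {u} u≢slot → trans (idle-agrees u≢slot) (filled-idle u)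
      where
      open Displaced ρw≡k
      open Repair (augment filled-oneShort (smaller filled-fewer-disagreements))

  module _ {N : ℕ} (τ<N : τ < N) (P Z : ℕ → Bool) (Z⊆P : ∀ u → Z u ≡ true → P u ≡ true) where

    -- idleIn l 𝒮 σ is idleOn (inSt l 𝒮) σ for N = slotBound τ l
    idleOn : (ℕ → Bool) → Schedule m → ℕ
    idleOn A σ = count (λ u → A u ∧ idleAt σ u) N

    target : ℕ → Bool
    target u = Z u ∧ idleAt σ₂ u

    conflict : Schedule m → ℕ → Bool
    conflict σ u = target u ∧ not (idleAt σ u)

    conflicts : Schedule m → ℕ
    conflicts σ = count (conflict σ) N

    Progress : Schedule m → Set
    Progress σ = ∃[ σ′ ] Feasible J σ′ × idleOn P σ ≤ idleOn P σ′ × conflicts σ′ < conflicts σ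

    repair-improves : ∀ {σ u} → u < N → conflict σ u ≡ true → Repair (σ [ u ≔ nothing ]) → Progress σ
    repair-improves {σ} {u} u<N clash (repaired σ′ v feasible′ σ₂-busy idle-agrees) =
      σ′ , feasible′ , s≤s⁻¹ (≤-trans (≤-reflexive idle-gained) idle-lost) , ≤-reflexive conflict-resolved
      where
      ρ : Schedule m
      ρ = σ [ u ≔ nothing ]
      v<N : v < N
      v<N with busy⇒just σ₂ v σ₂-busy
      ... | k , σ₂v≡k = ≤-<-trans (≤-trans (proj₂ (feasible⇒inWindows J {σ₂} feasible₂ σ₂v≡k)) (deadline≤τ k)) τ<N
      idle-gained : suc (idleOn P σ) ≡ idleOn P ρ
      idle-gained = count-flip N u<N (λ {x} x≢u → cong (P x ∧_) (sym (idleAt-update σ u nothing x≢u)))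
        (trans (cong (P u ∧_) (not-injective (∧-trueʳ clash))) (∧-zeroʳ (P u)))
        (cong₂ _∧_ (Z⊆P u (∧-trueˡ (∧-trueˡ clash))) (idleAt-update-at σ u nothing))
      idle-lost : idleOn P ρ ≤ suc (idleOn P σ′)
      idle-lost = count-except-≤ N v<N λ {x} x≢v → cong (P x ∧_) (sym (idle-agrees x≢v))
      untargeted : ∀ σ → conflict σ v ≡ false
      untargeted σ = cong (_∧ not (idleAt σ v)) (trans (cong (Z v ∧_) σ₂-busy) (∧-zeroʳ (Z v)))
      conflicts-agree : ∀ x → conflict σ′ x ≡ conflict ρ x
      conflicts-agree = except-at (λ {y} y≢v → cong (λ b → target y ∧ not b) (idle-agrees y≢v))
                                  (trans (untargeted σ′) (sym (untargeted ρ)))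
      conflict-resolved : suc (conflicts σ′) ≡ conflicts σ
      conflict-resolved = trans (cong suc (count-cong N λ {x} _ → conflicts-agree x))
        (count-flip N u<N (λ {x} x≢u → cong (λ b → target x ∧ not b) (idleAt-update σ u nothing x≢u))
          (trans (cong (λ b → target u ∧ not b) (idleAt-update-at σ u nothing)) (∧-zeroʳ (target u)))
          clash)

    release : ∀ {σ u} → Feasible J σ → u < N → conflict σ u ≡ true → Progress σ
    release {σ} {u} feasible u<N clash with busy⇒just σ u (not-injective (∧-trueʳ clash))
    ... | _ , σu≡k = repair-improves u<N clash (augment (vacate J {σ} feasible σu≡k) (<-wellFounded _))

    Improved : Schedule m → Set
    Improved σ = ∃[ σ′ ] Feasible J σ′ × idleOn P σ ≤ idleOn P σ′ × idleOn Z σ₂ ≤ idleOn Z σ′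

    resolve : ∀ {σ} → Feasible J σ → Acc _<_ (conflicts σ) → Improved σ
    resolve {σ} feasible (acc smaller) with anyUpTo? (λ u → conflict σ u Bool.≟ true) N
    ... | yes (u , u<N , clash) = continue (release feasible u<N clash)
      where
      continue : Progress σ → Improved σ
      continue (σ′ , feasible′ , gain , fewer) =
        Product.map₂ (Product.map₂ (Product.map₁ (≤-trans gain))) (resolve feasible′ (smaller fewer))
    ... | no  no-clash = σ , feasible , ≤-refl , count-mono N λ {u} u<N targeted →
      cong₂ _∧_ (∧-trueˡ targeted) (idle-unless-conflict (λ clash → no-clash (u , u<N , clash)) targeted)
      where
      idle-unless-conflict : ∀ {a b} → ¬ (a ∧ not b ≡ true) → a ≡ true → b ≡ true
      idle-unless-conflict {b = true}  _       _    = refl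
      idle-unless-conflict {b = false} ¬clash refl = contradiction refl ¬clash

    exchange : ∀ {σ₁} → Feasible J σ₁ → Improved σ₁
    exchange feasible₁ = resolve feasible₁ (<-wellFounded _)

lemma2 : {n τ m : ℕ} (l : Fin n → ℕ) (J : Fin m → Job)
    → (∀ j → (1 ≤ r (J j)) × (d (J j) ≤ τ))
    → JobsFeasible J
    → (S H : PairSet n τ) (a b c e : ℕ)
    → IsAgr l J S a → IsAgr l J H b
    → IsAgr l J (S ∪ᴸ H) c → IsAgr l J (S ∩ᴸ H) e
    → c + e ≤ a + b
-- Only the deadlines matter; feasibility of J is already witnessed by σ₁ and σ₂.
lemma2 {τ = τ} l J windows _ S H a b _ _ (_ , S-optimal) (_ , H-optimal)
       ((σ₁ , feasible₁ , refl) , _) ((σ₂ , feasible₂ , refl) , _) =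
  bound (exchange τ<N (inSt l (S ∪ᴸ H)) (inSt l (S ∩ᴸ H)) ∩⊆∪ feasible₁)
  where
  open ≤-Reasoning
  open Exchange J (proj₂ ∘ windows) {σ₂} feasible₂ using (exchange; Improved)
  τ<N : τ < slotBound τ l
  τ<N = s≤s (m≤m+n τ (sumFin l))
  ∩⊆∪ : ∀ u → inSt l (S ∩ᴸ H) u ≡ true → inSt l (S ∪ᴸ H) u ≡ true
  ∩⊆∪ u in-∩ = trans (inSt-∪ l S H u) (cong (_∨ inSt l H u) (inSt-∩ˡ l S H u in-∩))
  bound : Improved τ<N (inSt l (S ∪ᴸ H)) (inSt l (S ∩ᴸ H)) ∩⊆∪ σ₁ →
          idleIn l (S ∪ᴸ H) σ₁ + idleIn l (S ∩ᴸ H) σ₂ ≤ a + b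
  bound (σ , feasible , ∪-gain , ∩-gain) = begin
    idleIn l (S ∪ᴸ H) σ₁ + idleIn l (S ∩ᴸ H) σ₂ ≤⟨ +-mono-≤ ∪-gain ∩-gain ⟩
    idleIn l (S ∪ᴸ H) σ  + idleIn l (S ∩ᴸ H) σ  ≤⟨ idleIn-submodular l S H σ ⟩
    idleIn l S σ + idleIn l H σ                 ≤⟨ +-mono-≤ (S-optimal σ feasible) (H-optimal σ feasible) ⟩
    a + b                                       ∎
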